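{- Let $k$ be a positive integer and let $Q=\binom{\mathbf{a}}{k}$ be a $k$-biword. Let $\lambda:=\operatorname{sh}(S(\mathbf{a}))$ and suppose $\lambda^t=(c_1,\dots,c_m)$ with $c_1\ge\cdots\ge c_m$ (i.e. the column heights of $\lambda$ are $c_1,\dots,c_m$). Then $Q\sim Q_1C$, where $Q_1=\binom{\mathbf{a}_1}{k+1}$ is a $(k+1)$-biword with $\operatorname{sh}(S(\mathbf{a}_1))^t=(c_2,\dots,c_m)$ and $C=\binom{\mathbf{a}_c}{k}$ is a $k$-biword with $\operatorname{sh}(S(\mathbf{a}_c))^t=(c_1)$, and $Q_1C$ denotes concatenation.
   Context: A biletter is a pair of positive integers $\binom{a}{k}$ with $a\le k$. A plactic biword is a word of biletters $\binom{a_1,\dots,a_\ell}{k_1,\dots,k_\ell}$ with $k_1\ge k_2\ge\cdots\ge k_\ell$. If all $k_i$ equal a fixed $k$ it is called a $k$-biword and written $\binom{\mathbf{a}}{k}$ with $\mathbf{a}=a_1\cdots a_\ell$. The generalized Knuth relations on plactic biwords are (the dots denote arbitrary unchanged biletters on either side): (1) $\binom{\cdots\, b\, a\, c\,\cdots}{\cdots\, k\, k\, k\,\cdots}\sim\binom{\cdots\, b\, c\, a\,\cdots}{\cdots\, k\, k\, k\,\cdots}$ if $a<b\le c$; (2) $\binom{\cdots\, a\, c\, b\,\cdots}{\cdots\, k\, k\, k\,\cdots}\sim\binom{\cdots\, c\, a\, b\,\cdots}{\cdots\, k\, k\, k\,\cdots}$ if $a\le b<c$; (3) $\binom{\cdots\,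 a\, b\,\cdots}{\cdots\, k\, k\,\cdots}\sim\binom{\cdots\, a\, b\,\cdots}{\cdots\, k+1\, k\,\cdots}$ if $a\le b$; (4) $\binom{\cdots\, b\, a\,\cdots}{\cdots\, k+1\, k+1\,\cdots}\sim\binom{\cdots\, b\, a\,\cdots}{\cdots\, k+1\, k\,\cdots}$ if $a<b$. These moves are applied only when both sides are plactic biwords, and $\sim$ denotes the equivalence relation on plactic biwords generated by them. For a word $\mathbf{a}$ of positive integers, $S(\mathbf{a})$ is the semistandard Young tableau obtained by Schensted row insertion of the letters of $\mathbf{a}$ from left to right starting from the empty tableau; $\operatorname{sh}(T)$ is the shape (partition) of a tableau $T$, and $\lambda^t$ is the conjugate partition of $\lambda$. -}

module Defs where

open import Data.Nat using (ℕ; zero; suc; _≤_; _<_; _≥_; _<?_; _≤?_)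
open import Data.Product using (_×_; _,_)
open import Data.List using (List; []; _∷_; _++_; map; length; filter; upTo; foldl)
open import Data.Maybe using (Maybe; just; nothing)
open import Data.List.Relation.Unary.All using (All)
open import Data.List.Relation.Unary.Linked using (Linked)
open import Relation.Nullary using (yes; no)
open import Relation.Binary.Construct.Closure.Equivalence using (EqClosure)

-- A biletter (a over k) is represented as the pair (a , k).
Biletter : Set
Biletter = ℕ × ℕ

top : Biletter → ℕ
top (a , _) = a

bot : Biletter → ℕ
bot (_ , k) = k

ValidBiletter : Biletter → Set
ValidBiletter (a , k) = (1 ≤ a) × (a ≤ k)

Plactic : List Biletter → Set
Plactic w = All ValidBiletter w × Linked (λ x y → bot x ≥ bot y) w

kBiword : List ℕ → ℕ → List Biletter
kBiword as k = map (λ a → (a , k)) as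

IsKBiword : ℕ → List ℕ → Set
IsKBiword k as = Plactic (kBiword as k)

-- One application of a generalized Knuth relation (1)–(4), in the
-- left-to-right direction, inside an arbitrary context u _ v.
data KnuthMove : List Biletter → List Biletter → Set where
  rel1 : ∀ u v a b c k → a < b → b ≤ c →
    KnuthMove (u ++ (b , k) ∷ (a , k) ∷ (c , k) ∷ v)
              (u ++ (b , k) ∷ (c , k) ∷ (a , k) ∷ v)
  rel2 : ∀ u v a b c k → a ≤ b → b < c →
    KnuthMove (u ++ (a , k) ∷ (c , k) ∷ (b , k) ∷ v)
              (u ++ (c , k) ∷ (a , k) ∷ (b , k) ∷ v)
  rel3 : ∀ u v a b k → a ≤ b →
    KnuthMove (u ++ (a , k) ∷ (b , k) ∷ v)
              (u ++ (a , suc k) ∷ (b , k) ∷ v)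
  rel4 : ∀ u v a b k → a < b →
    KnuthMove (u ++ (b , suc k) ∷ (a , suc k) ∷ v)
              (u ++ (b , suc k) ∷ (a , k) ∷ v)

PlacticMove : List Biletter → List Biletter → Set
PlacticMove w w' = Plactic w × Plactic w' × KnuthMove w w'

infix 4 _∼_
_∼_ : List Biletter → List Biletter → Set
_∼_ = EqClosure PlacticMove

-- Tableaux as lists of rows (top row first), each row weakly increasing.
Tableau : Set
Tableau = List (List ℕ)

insertRow : ℕ → List ℕ → Maybe ℕ × List ℕ
insertRow x [] = nothing , x ∷ []
insertRow x (y ∷ ys) with x <? y
... | yes _ = just y , x ∷ ys
... | no _ with insertRow x ys
...   | (b , r) = b , y ∷ r

insertT : ℕ → Tableau → Tableau
insertT x [] = (x ∷ []) ∷ []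
insertT x (r ∷ rs) with insertRow x r
... | (nothing , r') = r' ∷ rs
... | (just y , r') = r' ∷ insertT y rs

S : List ℕ → Tableau
S as = foldl (λ T x → insertT x T) [] as

sh : Tableau → List ℕ
sh T = map length T

headOr0 : List ℕ → ℕ
headOr0 [] = 0
headOr0 (x ∷ _) = x

conj : List ℕ → List ℕ
conj λs = map (λ j → length (filter (λ l → suc j ≤? l) λs)) (upTo (headOr0 λs))

-- Schensted insertion is a chain of Knuth moves, so the k-biword of 𝐚 is equivalent to that of
-- the row reading word of T = S(𝐚). The rows of T are then processed from the bottom up while a
-- strictly decreasing column E of letters is carried along at level k. E is pushed into the next
-- row from the left by Knuth moves, each letter of E replacing the largest smaller entry, which is
-- ejected to the right; the last entry m of the resulting row is kept at level k, joining E, and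
-- the rest of the row is raised to level k + 1 by relation (3). The raised rows still form a
-- tableau, with one entry fewer in every row, so its reading word re-inserts to itself and has the
-- conjugate shape (c₂, …, c_m), while E, one letter per row of T, inserts to a column of height c₁.

module Submission where

open import Defs
open import Data.Nat using (ℕ; zero; suc; _≤_; _<_; _≥_; _>_; _<?_; _≤?_; z≤n; s≤s; _⊔_; pred)
open import Data.Nat.Properties
open import Data.List
  using (List; []; _∷_; _++_; _ʳ++_; reverse; initLast; _∷ʳ′_; map; length; filter; foldl; applyUpTo; upTo; [_])
open import Data.List.Properties
  using (filter-all; filter-accept; filter-reject; length-++; length-reverse; ʳ++-defn; ++-assoc; map-++
        ; ++-identityʳ; foldl-++; length-map; map-applyUpTo; ∷-injective)
open import Data.List.Relation.Unary.All as All using (All; []; _∷_)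
import Data.List.Relation.Unary.All.Properties as Allₚ
open import Data.List.Relation.Unary.AllPairs as AllPairs using (AllPairs; []; _∷_)
import Data.List.Relation.Unary.AllPairs.Properties as AllPairsₚ
open import Data.List.Relation.Unary.Linked using (Linked; []; [-]; _∷_)
open import Data.List.Relation.Binary.Permutation.Propositional
  using (_↭_; ↭-refl; ↭-reflexive; ↭-isEquivalence; prep; swap)
open import Data.List.Relation.Binary.Permutation.Propositional.Properties using (All-resp-↭; ++⁺ˡ)
open import Data.Product using (_×_; _,_; Σ; proj₁; proj₂; map₂)
open import Data.Sum using (_⊎_; inj₁; inj₂)
open import Data.Maybe using (just; nothing)
open import Data.Empty using (⊥-elim)
open import Data.Unit using (⊤; tt)
open import Function using (_∘_; id)
open import Relation.Binary.PropositionalEquality hiding ([_])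
open import Relation.Binary.Construct.Closure.Equivalence as EqClosure using (EqClosure; gmap; gfold)
open import Relation.Binary.Construct.Closure.ReflexiveTransitive using (ε; _◅_; _◅◅_)
open import Relation.Binary.Construct.Closure.Symmetric using (fwd; bwd)
open import Relation.Nullary using (Dec; yes; no)
import Relation.Binary.Reasoning.Setoid as SetoidReasoning

-- Knuth equivalence of words

data KnuthStep : List ℕ → List ℕ → Set where
  knuth₁ : ∀ p s {a b c} → a < b → b ≤ c → KnuthStep (p ++ b ∷ a ∷ c ∷ s) (p ++ b ∷ c ∷ a ∷ s)
  knuth₂ : ∀ p s {a b c} → a ≤ b → b < c → KnuthStep (p ++ a ∷ c ∷ b ∷ s) (p ++ c ∷ a ∷ b ∷ s)

infix 4 _≈ᴷ_
_≈ᴷ_ : List ℕ → List ℕ → Set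
_≈ᴷ_ = EqClosure KnuthStep

module ≈ᴷ-Reasoning = SetoidReasoning (EqClosure.setoid KnuthStep)

≡⇒≈ᴷ : ∀ {L L′} → L ≡ L′ → L ≈ᴷ L′
≡⇒≈ᴷ refl = ε

++-regroup : ∀ (p q : List ℕ) x y z (t s : List ℕ) →
  p ++ (q ++ x ∷ y ∷ z ∷ t) ++ s ≡ (p ++ q) ++ x ∷ y ∷ z ∷ (t ++ s)
++-regroup p q x y z t s = trans (cong (p ++_) (++-assoc q _ s)) (sym (++-assoc p q _))

KnuthStep-cong : ∀ p s {L L′} → KnuthStep L L′ → KnuthStep (p ++ L ++ s) (p ++ L′ ++ s)
KnuthStep-cong p s (knuth₁ q t {a} {b} {c} a<b b≤c)
  rewrite ++-regroup p q b a c t s | ++-regroup p q b c a t s = knuth₁ (p ++ q) (t ++ s) a<b b≤c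
KnuthStep-cong p s (knuth₂ q t {a} {b} {c} a≤b b<c)
  rewrite ++-regroup p q a c b t s | ++-regroup p q c a b t s = knuth₂ (p ++ q) (t ++ s) a≤b b<c

≈ᴷ-cong : ∀ p s {L L′} → L ≈ᴷ L′ → p ++ L ++ s ≈ᴷ p ++ L′ ++ s
≈ᴷ-cong p s = gmap (λ L → p ++ L ++ s) (KnuthStep-cong p s)

≈ᴷ-congʳ : ∀ s {L L′} → L ≈ᴷ L′ → L ++ s ≈ᴷ L′ ++ s
≈ᴷ-congʳ = ≈ᴷ-cong []

≈ᴷ-congˡ : ∀ p {L L′} → L ≈ᴷ L′ → p ++ L ≈ᴷ p ++ L′
≈ᴷ-congˡ p {L} {L′} L≈L′ =
  subst₂ (λ M M′ → p ++ M ≈ᴷ p ++ M′) (++-identityʳ L) (++-identityʳ L′) (≈ᴷ-cong p [] L≈L′)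

KnuthStep⇒↭ : ∀ {L L′} → KnuthStep L L′ → L ↭ L′
KnuthStep⇒↭ (knuth₁ p s _ _) = ++⁺ˡ p (prep _ (swap _ _ ↭-refl))
KnuthStep⇒↭ (knuth₂ p s _ _) = ++⁺ˡ p (swap _ _ ↭-refl)

-- A pair (U , L) stands for the plactic biword (U over k+1)(L over k).
data TwoLevelStep : List ℕ × List ℕ → List ℕ × List ℕ → Set where
  lower : ∀ U {L L′} → KnuthStep L L′ → TwoLevelStep (U , L) (U , L′)
  raise : ∀ U s {a b} → a ≤ b → TwoLevelStep (U , a ∷ b ∷ s) (U ++ [ a ] , b ∷ s)

infix 4 _⇝_
_⇝_ : List ℕ × List ℕ → List ℕ × List ℕ → Set
_⇝_ = EqClosure TwoLevelStep

module ⇝-Reasoning = SetoidReasoning (EqClosure.setoid TwoLevelStep)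

≡⇒⇝ : ∀ {x y} → x ≡ y → x ⇝ y
≡⇒⇝ refl = ε

lower* : ∀ U {L L′} → L ≈ᴷ L′ → (U , L) ⇝ (U , L′)
lower* U = gmap (U ,_) (lower U)

flatten : List ℕ × List ℕ → List ℕ
flatten (U , L) = U ++ L

⇝⇒↭ : ∀ {x y} → x ⇝ y → flatten x ↭ flatten y
⇝⇒↭ = gfold ↭-isEquivalence flatten step⇒↭
  where
  step⇒↭ : ∀ {x y} → TwoLevelStep x y → flatten x ↭ flatten y
  step⇒↭ (lower U m) = ++⁺ˡ U (KnuthStep⇒↭ m)
  step⇒↭ (raise U s {a} {b} _) = ↭-reflexive (sym (++-assoc U [ a ] (b ∷ s)))

Letter : ℕ → ℕ → Set
Letter m a = ValidBiletter (a , m)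

Letter-suc : ∀ {m a} → Letter m a → Letter (suc m) a
Letter-suc (1≤a , a≤m) = 1≤a , m≤n⇒m≤1+n a≤m

Linked-kBiword : ∀ m L → Linked (λ x y → bot x ≥ bot y) (kBiword L m)
Linked-kBiword m [] = []
Linked-kBiword m (x ∷ []) = [-]
Linked-kBiword m (x ∷ y ∷ L) = ≤-refl ∷ Linked-kBiword m (y ∷ L)

Plactic-kBiword : ∀ m L → All (Letter m) L → Plactic (kBiword L m)
Plactic-kBiword m L valid = Allₚ.map⁺ valid , Linked-kBiword m L

module TwoLevel (k : ℕ) where

  biword : List ℕ × List ℕ → List Biletter
  biword (U , L) = kBiword U (suc k) ++ kBiword L k

  Linked-biword : ∀ U L → Linked (λ x y → bot x ≥ bot y) (biword (U , L))
  Linked-biword [] L = Linked-kBiword k L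
  Linked-biword (u ∷ []) [] = [-]
  Linked-biword (u ∷ []) (x ∷ L) = n≤1+n k ∷ Linked-kBiword k (x ∷ L)
  Linked-biword (u ∷ v ∷ U) L = ≤-refl ∷ Linked-biword (v ∷ U) L

  Plactic-biword : ∀ x → All (Letter k) (flatten x) → Plactic (biword x)
  Plactic-biword (U , L) valid =
    Allₚ.++⁺ (Allₚ.map⁺ (All.map Letter-suc (Allₚ.++⁻ˡ U valid)))
            (Allₚ.map⁺ (Allₚ.++⁻ʳ U valid)) ,
    Linked-biword U L

  biword-split : ∀ U p M s →
    biword (U , p ++ M ++ s) ≡ (kBiword U (suc k) ++ kBiword p k) ++ kBiword M k ++ kBiword s k
  biword-split U p M s = begin
    kBiword U (suc k) ++ kBiword (p ++ M ++ s) k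
      ≡⟨ cong (kBiword U (suc k) ++_) (trans (map-++ _ p (M ++ s)) (cong (kBiword p k ++_) (map-++ _ M s))) ⟩
    kBiword U (suc k) ++ kBiword p k ++ kBiword M k ++ kBiword s k
      ≡⟨ ++-assoc (kBiword U (suc k)) (kBiword p k) _ ⟨
    (kBiword U (suc k) ++ kBiword p k) ++ kBiword M k ++ kBiword s k ∎
    where open ≡-Reasoning

  step⇒KnuthMove : ∀ {x y} → TwoLevelStep x y → KnuthMove (biword x) (biword y)
  step⇒KnuthMove (lower U (knuth₁ p s {a} {b} {c} a<b b≤c)) =
    subst₂ KnuthMove (sym (biword-split U p (b ∷ a ∷ c ∷ []) s)) (sym (biword-split U p (b ∷ c ∷ a ∷ []) s))
      (rel1 (kBiword U (suc k) ++ kBiword p k) (kBiword s k) a b c k a<b b≤c)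
  step⇒KnuthMove (lower U (knuth₂ p s {a} {b} {c} a≤b b<c)) =
    subst₂ KnuthMove (sym (biword-split U p (a ∷ c ∷ b ∷ []) s)) (sym (biword-split U p (c ∷ a ∷ b ∷ []) s))
      (rel2 (kBiword U (suc k) ++ kBiword p k) (kBiword s k) a b c k a≤b b<c)
  step⇒KnuthMove (raise U s {a} {b} a≤b) =
    subst (KnuthMove (biword (U , a ∷ b ∷ s))) (sym raised)
      (rel3 (kBiword U (suc k)) (kBiword s k) a b k a≤b)
    where
    raised : biword (U ++ [ a ] , b ∷ s) ≡ kBiword U (suc k) ++ (a , suc k) ∷ kBiword (b ∷ s) k
    raised = trans (cong (_++ kBiword (b ∷ s) k) (map-++ _ U [ a ])) (++-assoc (kBiword U (suc k)) _ _)

  ⇝⇒∼ : ∀ {x y} → x ⇝ y → All (Letter k) (flatten x) → biword x ∼ biword y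
  ⇝⇒∼ ε _ = ε
  ⇝⇒∼ {x} (_◅_ {j = y} (fwd m) rest) valid =
    let valid′ = All-resp-↭ (⇝⇒↭ (fwd m ◅ ε)) valid in
    fwd (Plactic-biword x valid , Plactic-biword y valid′ , step⇒KnuthMove m) ◅ ⇝⇒∼ rest valid′
  ⇝⇒∼ {x} (_◅_ {j = y} (bwd m) rest) valid =
    let valid′ = All-resp-↭ (⇝⇒↭ (bwd m ◅ ε)) valid in
    bwd (Plactic-biword y valid′ , Plactic-biword x valid , step⇒KnuthMove m) ◅ ⇝⇒∼ rest valid′

NonEmpty : {A : Set} → List A → Set
NonEmpty R = 0 < length R

Row : List ℕ → Set
Row = AllPairs _≤_

Row-++⁻ˡ : ∀ A {B} → Row (A ++ B) → Row A
Row-++⁻ˡ [] _ = []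
Row-++⁻ˡ (x ∷ A) (xAB ∷ rAB) = Allₚ.++⁻ˡ A xAB ∷ Row-++⁻ˡ A rAB

Row-++⁻ʳ : ∀ A {B} → Row (A ++ B) → Row B
Row-++⁻ʳ [] r = r
Row-++⁻ʳ (x ∷ A) (_ ∷ rAB) = Row-++⁻ʳ A rAB

Row-snoc : ∀ {R x} → Row R → All (_≤ x) R → Row (R ++ [ x ])
Row-snoc r R≤x = AllPairsₚ.++⁺ r ([] ∷ []) (All.map (_∷ []) R≤x)

Row-update : ∀ P {y Q x} → Row (P ++ y ∷ Q) → All (_≤ x) P → All (x ≤_) Q → Row (P ++ x ∷ Q)
Row-update [] (_ ∷ rQ) [] x≤Q = x≤Q ∷ rQ
Row-update (p ∷ P) (p≤PyQ ∷ r) (p≤x ∷ P≤x) x≤Q =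
  Allₚ.++⁺ (Allₚ.++⁻ˡ P p≤PyQ) (p≤x ∷ All.tail (Allₚ.++⁻ʳ P p≤PyQ)) ∷ Row-update P r P≤x x≤Q

Row-prefix-≤ : ∀ P {y} Q → Row (P ++ y ∷ Q) → All (_≤ y) P
Row-prefix-≤ [] Q _ = []
Row-prefix-≤ (p ∷ P) Q (p≤PyQ ∷ r) = All.head (Allₚ.++⁻ʳ P p≤PyQ) ∷ Row-prefix-≤ P Q r

snoc-≈ᴷ-after-head : ∀ y Q x → Row (y ∷ Q) → x < y → y ∷ Q ++ [ x ] ≈ᴷ y ∷ x ∷ Q
snoc-≈ᴷ-after-head y [] x _ _ = ε
snoc-≈ᴷ-after-head y (q ∷ Q) x ((y≤q ∷ _) ∷ r) x<y =
  ≈ᴷ-congˡ [ y ] (snoc-≈ᴷ-after-head q Q x r (<-≤-trans x<y y≤q)) ◅◅ bwd (knuth₁ [] Q x<y y≤q) ◅ ε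

≈ᴷ-jump-over-row : ∀ P y b s → Row P → All (_≤ b) P → b < y → P ++ y ∷ b ∷ s ≈ᴷ y ∷ P ++ b ∷ s
≈ᴷ-jump-over-row [] y b s _ _ _ = ε
≈ᴷ-jump-over-row (p ∷ []) y b s _ (p≤b ∷ []) b<y = fwd (knuth₂ [] s p≤b b<y) ◅ ε
≈ᴷ-jump-over-row (p ∷ p′ ∷ P) y b s ((p≤p′ ∷ _) ∷ r) (_ ∷ P≤b@(p′≤b ∷ _)) b<y =
  ≈ᴷ-congˡ [ p ] (≈ᴷ-jump-over-row (p′ ∷ P) y b s r P≤b b<y)
  ◅◅ fwd (knuth₂ [] (P ++ b ∷ s) p≤p′ (≤-<-trans p′≤b b<y)) ◅ ε

row-bump-≈ᴷ : ∀ P y Q x → Row (P ++ y ∷ Q) → All (_≤ x) P → x < y →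
  (P ++ y ∷ Q) ++ [ x ] ≈ᴷ y ∷ P ++ x ∷ Q
row-bump-≈ᴷ P y Q x r P≤x x<y = begin
  (P ++ y ∷ Q) ++ [ x ] ≡⟨ ++-assoc P (y ∷ Q) [ x ] ⟩
  P ++ y ∷ Q ++ [ x ]   ≈⟨ ≈ᴷ-congˡ P (snoc-≈ᴷ-after-head y Q x (Row-++⁻ʳ P r) x<y) ⟩
  P ++ y ∷ x ∷ Q        ≈⟨ ≈ᴷ-jump-over-row P y x Q (Row-++⁻ˡ P r) P≤x x<y ⟩
  y ∷ P ++ x ∷ Q        ∎
  where open ≈ᴷ-Reasoning

insertRow-appends : ∀ x R → All (_≤ x) R → insertRow x R ≡ (nothing , R ++ [ x ])
insertRow-appends x [] _ = refl
insertRow-appends x (y ∷ ys) (y≤x ∷ ys≤x) with x <? y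
... | yes x<y = ⊥-elim (<⇒≱ x<y y≤x)
... | no _ rewrite insertRow-appends x ys ys≤x = refl

insertRow-bumps : ∀ x P y Q → All (_≤ x) P → x < y → insertRow x (P ++ y ∷ Q) ≡ (just y , P ++ x ∷ Q)
insertRow-bumps x [] y Q _ x<y with x <? y
... | yes _ = refl
... | no x≮y = ⊥-elim (x≮y x<y)
insertRow-bumps x (p ∷ P) y Q (p≤x ∷ P≤x) x<y with x <? p
... | yes x<p = ⊥-elim (<⇒≱ x<p p≤x)
... | no _ rewrite insertRow-bumps x P y Q P≤x x<y = refl

data RowInsertion (x : ℕ) : List ℕ → Set where
  appends : ∀ {R} → All (_≤ x) R → RowInsertion x R
  bumps : ∀ P y Q → All (_≤ x) P → x < y → RowInsertion x (P ++ y ∷ Q)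

rowInsertion : ∀ x R → RowInsertion x R
rowInsertion x [] = appends []
rowInsertion x (y ∷ ys) with x <? y
... | yes x<y = bumps [] y ys [] x<y
... | no x≮y with rowInsertion x ys
...   | appends ys≤x = appends (≮⇒≥ x≮y ∷ ys≤x)
...   | bumps P z Q P≤x x<z = bumps (y ∷ P) z Q (≮⇒≥ x≮y ∷ P≤x) x<z

-- Tableaux and the reading word

reading : Tableau → List ℕ
reading [] = []
reading (R ∷ T) = reading T ++ R

insertT-≈ᴷ : ∀ x T → All Row T → reading T ++ [ x ] ≈ᴷ reading (insertT x T)
insertT-≈ᴷ x [] _ = ε
insertT-≈ᴷ x (R ∷ T) (r ∷ rs) with rowInsertion x R
... | appends R≤x rewrite insertRow-appends x R R≤x = ≡⇒≈ᴷ (++-assoc (reading T) R [ x ])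
... | bumps P y Q P≤x x<y rewrite insertRow-bumps x P y Q P≤x x<y = begin
  (reading T ++ P ++ y ∷ Q) ++ [ x ]   ≡⟨ ++-assoc (reading T) (P ++ y ∷ Q) [ x ] ⟩
  reading T ++ (P ++ y ∷ Q) ++ [ x ]   ≈⟨ ≈ᴷ-congˡ (reading T) (row-bump-≈ᴷ P y Q x r P≤x x<y) ⟩
  reading T ++ y ∷ P ++ x ∷ Q         ≡⟨ ++-assoc (reading T) [ y ] (P ++ x ∷ Q) ⟨
  (reading T ++ [ y ]) ++ P ++ x ∷ Q   ≈⟨ ≈ᴷ-congʳ (P ++ x ∷ Q) (insertT-≈ᴷ y T rs) ⟩
  reading (insertT y T) ++ P ++ x ∷ Q  ∎
  where open ≈ᴷ-Reasoning

-- Entries are indexed from 0; past the end of the row `at` returns the junk value 0.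
at : List ℕ → ℕ → ℕ
at [] _ = 0
at (x ∷ _) zero = x
at (_ ∷ l) (suc i) = at l i

at-mid : ∀ P x Q → at (P ++ x ∷ Q) (length P) ≡ x
at-mid [] x Q = refl
at-mid (p ∷ P) x Q = at-mid P x Q

at-++ˡ : ∀ P Q i → i < length P → at (P ++ Q) i ≡ at P i
at-++ˡ (p ∷ P) Q zero _ = refl
at-++ˡ (p ∷ P) Q (suc i) (s≤s i<P) = at-++ˡ P Q i i<P

at-update : ∀ P x y Q i → i ≢ length P → at (P ++ x ∷ Q) i ≡ at (P ++ y ∷ Q) i
at-update [] x y Q zero i≢0 = ⊥-elim (i≢0 refl)
at-update [] x y Q (suc i) _ = refl
at-update (p ∷ P) x y Q zero _ = refl
at-update (p ∷ P) x y Q (suc i) i≢ = at-update P x y Q i (i≢ ∘ cong suc)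

at-update-≤ : ∀ P {x y} Q → x ≤ y → ∀ i → at (P ++ x ∷ Q) i ≤ at (P ++ y ∷ Q) i
at-update-≤ P {x} {y} Q x≤y i with i ≟ length P
... | yes refl = subst₂ _≤_ (sym (at-mid P x Q)) (sym (at-mid P y Q)) x≤y
... | no i≢ = ≤-reflexive (at-update P x y Q i i≢)

All-at : ∀ {P : ℕ → Set} {R} → All P R → ∀ i → i < length R → P (at R i)
All-at (p ∷ _) zero _ = p
All-at (_ ∷ ps) (suc i) (s≤s i<R) = All-at ps i i<R

Row-at-mono : ∀ {R} → Row R → ∀ {i j} → i ≤ j → j < length R → at R i ≤ at R j
Row-at-mono (_ ∷ _) {zero} {zero} _ _ = ≤-refl
Row-at-mono (r≤R ∷ _) {zero} {suc j} _ (s≤s j<R) = All-at r≤R j j<R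
Row-at-mono (_ ∷ rR) {suc i} {suc j} (s≤s i≤j) (s≤s j<R) = Row-at-mono rR i≤j j<R

length-mid : ∀ (P : List ℕ) y Q → length P < length (P ++ y ∷ Q)
length-mid [] y Q = s≤s z≤n
length-mid (p ∷ P) y Q = s≤s (length-mid P y Q)

length-update : ∀ (P : List ℕ) x y Q → length (P ++ x ∷ Q) ≡ length (P ++ y ∷ Q)
length-update P x y Q = trans (length-++ P) (sym (length-++ P))

length-snoc : ∀ (R : List ℕ) x → length (R ++ [ x ]) ≡ suc (length R)
length-snoc R x = trans (length-++ R) (+-comm (length R) 1)

Above : List ℕ → List ℕ → Set
Above A B = length B ≤ length A × (∀ i → i < length B → at A i < at B i)

Above-[] : ∀ A → Above A []
Above-[] A = z≤n , λ _ ()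

Above-snoc : ∀ A x B → Above A B → Above (A ++ [ x ]) B
Above-snoc A x B (|B|≤|A| , A<B) =
  ≤-trans |B|≤|A| (subst (length A ≤_) (sym (length-snoc A x)) (n≤1+n _)) ,
  λ i i<B → subst (_< at B i) (sym (at-++ˡ A [ x ] i (<-≤-trans i<B |B|≤|A|))) (A<B i i<B)

Above-unsnoc : ∀ A x B → Above (A ++ [ x ]) B → length B ≤ length A → Above A B
Above-unsnoc A x B (_ , A<B) B≤A =
  B≤A , λ i i<B → subst (_< at B i) (at-++ˡ A [ x ] i (<-≤-trans i<B B≤A)) (A<B i i<B)

Above-≤ʳ : ∀ A B W → Above A B → length W ≤ length B → (∀ i → i < length W → at B i ≤ at W i) → Above A W
Above-≤ʳ A B W (B≤A , A<B) W≤B B≤W = ≤-trans W≤B B≤A , λ i i<W → <-≤-trans (A<B i (<-≤-trans i<W W≤B)) (B≤W i i<W)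

firstRow : Tableau → List ℕ
firstRow [] = []
firstRow (R ∷ _) = R

IsTableau : Tableau → Set
IsTableau [] = ⊤
IsTableau (R ∷ T) = Row R × Above R (firstRow T) × IsTableau T

IsTableau⇒Rows : ∀ T → IsTableau T → All Row T
IsTableau⇒Rows [] _ = []
IsTableau⇒Rows (R ∷ T) (r , _ , t) = r ∷ IsTableau⇒Rows T t

firstRow-insertT : ∀ x T → firstRow (insertT x T) ≡ proj₂ (insertRow x (firstRow T))
firstRow-insertT x [] = refl
firstRow-insertT x (R ∷ T) with insertRow x R
... | nothing , _ = refl
... | just _ , _ = refl

at-update-left-< : ∀ P {x y} Q → All (_≤ x) P → x < y → ∀ i → i ≤ length P → at (P ++ x ∷ Q) i < y
at-update-left-< P {x} {y} Q P≤x x<y i i≤P with i ≟ length P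
... | yes refl = subst (_< y) (sym (at-mid P x Q)) x<y
... | no i≢ = subst (_< y) (sym (at-++ˡ P (x ∷ Q) i i<P)) (≤-<-trans (All-at P≤x i i<P) x<y)
  where
  i<P : i < length P
  i<P = ≤∧≢⇒< i≤P i≢

-- An entry y of row A, bumped into the row below, lands weakly left of its own column.
bump-lands-left : ∀ P y Q R → Above (P ++ y ∷ Q) R →
  ∀ q → q ≤ length R → (∀ i → i < q → at R i ≤ y) → q ≤ length P
bump-lands-left P y Q R (_ , A<R) q q≤R R≤y with q ≤? length P
... | yes q≤P = q≤P
... | no q≰P = ⊥-elim (<⇒≱ (subst (_< at R (length P)) (at-mid P y Q) (A<R (length P) (<-≤-trans P<q q≤R)))
                            (R≤y (length P) P<q))
  where
  P<q : length P < q
  P<q = ≰⇒> q≰P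

Above-bump : ∀ P y Q x R → All (_≤ x) P → x < y → Above (P ++ y ∷ Q) R →
  Above (P ++ x ∷ Q) (proj₂ (insertRow y R))
Above-bump P y Q x R P≤x x<y ab@(R≤A , A<R) with rowInsertion y R
... | appends R≤y rewrite insertRow-appends y R R≤y =
  subst (_≤ length (P ++ x ∷ Q)) (sym (length-snoc R y)) (≤-<-trans R≤P (length-mid P x Q)) ,
  λ i i<R′ → entry i (m≤n⇒m<n∨m≡n (≤-pred (subst (i <_) (length-snoc R y) i<R′)))
  where
  R≤P : length R ≤ length P
  R≤P = bump-lands-left P y Q R ab (length R) ≤-refl (All-at R≤y)
  entry : ∀ i → i < length R ⊎ i ≡ length R → at (P ++ x ∷ Q) i < at (R ++ [ y ]) i
  entry i (inj₁ i<R) rewrite at-++ˡ R [ y ] i i<R =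
    ≤-<-trans (at-update-≤ P Q (<⇒≤ x<y) i) (A<R i i<R)
  entry i (inj₂ refl) rewrite at-mid R y [] = at-update-left-< P Q P≤x x<y i R≤P
... | bumps P₂ z Q₂ P₂≤y y<z rewrite insertRow-bumps y P₂ z Q₂ P₂≤y y<z =
  subst₂ _≤_ (length-update P₂ z y Q₂) (length-update P y x Q) R≤A ,
  λ i i<R′ → entry i (i ≟ length P₂) (subst (i <_) (length-update P₂ y z Q₂) i<R′)
  where
  P₂≤P : length P₂ ≤ length P
  P₂≤P = bump-lands-left P y Q (P₂ ++ z ∷ Q₂) ab (length P₂) (<⇒≤ (length-mid P₂ z Q₂))
           (λ i i<P₂ → subst (_≤ y) (sym (at-++ˡ P₂ (z ∷ Q₂) i i<P₂)) (All-at P₂≤y i i<P₂))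
  entry : ∀ i → Dec (i ≡ length P₂) → i < length (P₂ ++ z ∷ Q₂) → at (P ++ x ∷ Q) i < at (P₂ ++ y ∷ Q₂) i
  entry i (yes refl) _ rewrite at-mid P₂ y Q₂ = at-update-left-< P Q P≤x x<y i P₂≤P
  entry i (no i≢) i<R rewrite at-update P₂ y z Q₂ i i≢ =
    ≤-<-trans (at-update-≤ P Q (<⇒≤ x<y) i) (A<R i i<R)

insertT-IsTableau : ∀ x T → IsTableau T → IsTableau (insertT x T)
insertT-IsTableau x [] _ = [] ∷ [] , Above-[] _ , tt
insertT-IsTableau x (A ∷ T) (r , ab , t) with rowInsertion x A
... | appends A≤x rewrite insertRow-appends x A A≤x = Row-snoc r A≤x , Above-snoc A x (firstRow T) ab , t
... | bumps P y Q P≤x x<y rewrite insertRow-bumps x P y Q P≤x x<y =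
  Row-update P r P≤x (All.map (≤-trans (<⇒≤ x<y)) (AllPairs.head (Row-++⁻ʳ P r))) ,
  subst (Above (P ++ x ∷ Q)) (sym (firstRow-insertT y T)) (Above-bump P y Q x (firstRow T) P≤x x<y ab) ,
  insertT-IsTableau y T t

insertT-NonEmpty : ∀ x T → All NonEmpty T → All NonEmpty (insertT x T)
insertT-NonEmpty x [] _ = s≤s z≤n ∷ []
insertT-NonEmpty x (A ∷ T) (_ ∷ ne) with rowInsertion x A
... | appends A≤x rewrite insertRow-appends x A A≤x = subst (0 <_) (sym (length-snoc A x)) (s≤s z≤n) ∷ ne
... | bumps P y Q P≤x x<y rewrite insertRow-bumps x P y Q P≤x x<y =
  ≤-<-trans z≤n (length-mid P x Q) ∷ insertT-NonEmpty y T ne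

insertWord : Tableau → List ℕ → Tableau
insertWord T as = foldl (λ T x → insertT x T) T as

S-IsTableau : ∀ as → IsTableau (S as) × All NonEmpty (S as)
S-IsTableau as = go as [] tt []
  where
  go : ∀ as T → IsTableau T → All NonEmpty T →
       IsTableau (insertWord T as) × All NonEmpty (insertWord T as)
  go [] T t ne = t , ne
  go (x ∷ as) T t ne = go as (insertT x T) (insertT-IsTableau x T t) (insertT-NonEmpty x T ne)

S-≈ᴷ : ∀ as → as ≈ᴷ reading (S as)
S-≈ᴷ as = go as [] tt
  where
  go : ∀ as T → IsTableau T → reading T ++ as ≈ᴷ reading (insertWord T as)
  go [] T _ = ≡⇒≈ᴷ (++-identityʳ (reading T))
  go (x ∷ as) T t = begin
    reading T ++ x ∷ as           ≡⟨ ++-assoc (reading T) [ x ] as ⟨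
    (reading T ++ [ x ]) ++ as     ≈⟨ ≈ᴷ-congʳ as (insertT-≈ᴷ x T (IsTableau⇒Rows T t)) ⟩
    reading (insertT x T) ++ as    ≈⟨ go as (insertT x T) (insertT-IsTableau x T t) ⟩
    reading (insertWord (insertT x T) as) ∎
    where open ≈ᴷ-Reasoning

-- Pushing a column into a row

data SplitAt (d : ℕ) : List ℕ → Set where
  split : ∀ P {d′} Q → d′ < d → All (d ≤_) Q → SplitAt d (P ++ d′ ∷ Q)

splitAt : ∀ d R → Row R → NonEmpty R → at R 0 < d → SplitAt d R
splitAt d (r ∷ []) _ _ r<d = split [] [] r<d []
splitAt d (r ∷ r′ ∷ R) (_ ∷ row) _ r<d with d ≤? r′
... | yes d≤r′ = split [] (r′ ∷ R) r<d (d≤r′ ∷ All.map (≤-trans d≤r′) (AllPairs.head row))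
... | no d≰r′ = cons (splitAt d (r′ ∷ R) row (s≤s z≤n) (≰⇒> d≰r′))
  where
  cons : ∀ {R} → SplitAt d R → SplitAt d (r ∷ R)
  cons (split P Q d′<d d≤Q) = split (r ∷ P) Q d′<d d≤Q

split-left : ∀ P y Q {d} → All (d ≤_) Q → ∀ π → π < length (P ++ y ∷ Q) → at (P ++ y ∷ Q) π < d → π ≤ length P
split-left [] y Q d≤Q zero _ _ = z≤n
split-left [] y Q d≤Q (suc π) (s≤s π<Q) Qπ<d = ⊥-elim (<⇒≱ Qπ<d (All-at d≤Q π π<Q))
split-left (p ∷ P) y Q d≤Q zero _ _ = z≤n
split-left (p ∷ P) y Q d≤Q (suc π) (s≤s π<) lt = s≤s (split-left P y Q d≤Q π π< lt)

split-≈ᴷ : ∀ P {d′ d} Q → Row (P ++ d′ ∷ Q) → d′ < d → All (d ≤_) Q → d ∷ P ++ d′ ∷ Q ≈ᴷ (P ++ d ∷ Q) ++ [ d′ ]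
split-≈ᴷ P {d′} {d} Q row d′<d d≤Q =
  EqClosure.symmetric KnuthStep (row-bump-≈ᴷ P _ Q _ (Row-update P row P≤d d≤Q) P≤d′ d′<d)
  where
  P≤d′ : All (_≤ d′) P
  P≤d′ = Row-prefix-≤ P Q row
  P≤d : All (_≤ d) P
  P≤d = All.map (λ p≤d′ → ≤-trans p≤d′ (<⇒≤ d′<d)) P≤d′

Decreasing : List ℕ → Set
Decreasing = AllPairs _>_

headOr0-< : ∀ {D d} → All (_< d) D → 0 < d → headOr0 D < d
headOr0-< [] 0<d = 0<d
headOr0-< (h<d ∷ _) _ = h<d

OccursIn : List ℕ → List ℕ → Set
OccursIn [] R = ⊤
OccursIn (d ∷ _) R = Σ ℕ λ p → p < length R × at R p ≡ d

-- Records where a letter e of the carried column came from: some column π of row B with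
-- B[π] ∼ e, while e is smaller than every entry of W from column π on.
Wedged : (ℕ → ℕ → Set) → List ℕ → List ℕ → ℕ → Set
Wedged _∼_ B W e = Σ ℕ λ π → π < length B × at B π ∼ e × (∀ p → π ≤ p → p < length W → e < at W p)

Wedged-mono : ∀ {_∼_ e} B W W′ → length W′ ≤ length W → (∀ i → i < length W′ → at W i ≤ at W′ i) →
  Wedged _∼_ B W e → Wedged _∼_ B W′ e
Wedged-mono B W W′ W′≤W W≤W′ (π , π<B , Bπ∼e , e<W) =
  π , π<B , Bπ∼e , λ i π≤i i<W′ → <-≤-trans (e<W i π≤i (<-≤-trans i<W′ W′≤W)) (W≤W′ i i<W′)

Wedged-up : ∀ A B W {e} → Above A B → Wedged _≤_ B W e → Wedged _<_ A W e
Wedged-up A B W (B≤A , A<B) (π , π<B , Bπ≤e , e<W) = π , <-≤-trans π<B B≤A , <-≤-trans (A<B π π<B) Bπ≤e , e<W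

Wedged-<-head : ∀ {A W e} → Row A → Wedged _<_ A W e → at A 0 < e
Wedged-<-head row (π , π<A , Aπ<e , _) = ≤-<-trans (Row-at-mono row z≤n π<A) Aπ<e

-- The column D (read bottom to top) is pushed into the row A from the left; the entries it
-- replaces leave A as the column `col`.
record Pass (D A row col : List ℕ) : Set where
  field
    pass-≈ᴷ : D ++ A ≈ᴷ row ++ col
    row-Row : Row row
    row-length : length row ≡ length A
    row-≥ : ∀ p → at A p ≤ at row p
    row-≤ : ∀ p → at row p ≤ at A p ⊔ headOr0 D
    row-Above : ∀ W → Above A W → All (Wedged _<_ A W) D → Above row W
    head-occurs : OccursIn D row
    col-length : length col ≡ length D
    col-Decreasing : Decreasing col
    col-< : All (_< headOr0 D) col
    col-ejected : All (Wedged _≤_ A row) col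

head-≤-split : ∀ D P {d′ d} Q → All (d ≤_) Q → Row (P ++ d′ ∷ Q) → OccursIn D (P ++ d′ ∷ Q) →
  All (_< d) D → headOr0 D ≤ d′
head-≤-split [] P Q _ _ _ _ = z≤n
head-≤-split (_ ∷ _) P {d′} Q d≤Q row (π , π< , refl) (Aπ<d ∷ _) =
  subst (at (P ++ d′ ∷ Q) π ≤_) (at-mid P d′ Q)
    (Row-at-mono row (split-left P d′ Q d≤Q π π< Aπ<d) (length-mid P d′ Q))

head-≤-last : ∀ D W m → Row (W ++ [ m ]) → OccursIn D (W ++ [ m ]) → headOr0 D ≤ m
head-≤-last [] W m _ _ = z≤n
head-≤-last (_ ∷ _) W m row (π , π< , refl) =
  subst (at (W ++ [ m ]) π ≤_) (at-mid W m [])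
    (Row-at-mono row (≤-pred (subst (π <_) (length-snoc W m) π<)) (length-mid W m []))

pass : ∀ D A → Row A → NonEmpty A → Decreasing D → All (at A 0 <_) D →
  Σ (List ℕ) λ row → Σ (List ℕ) λ col → Pass D A row col
pass [] A rA _ _ _ = A , [] , record
  { pass-≈ᴷ = ≡⇒≈ᴷ (sym (++-identityʳ A)) ; row-Row = rA ; row-length = refl ; row-≥ = λ _ → ≤-refl
  ; row-≤ = λ i → m≤m⊔n (at A i) 0 ; row-Above = λ _ ab _ → ab ; head-occurs = tt
  ; col-length = refl ; col-Decreasing = [] ; col-< = [] ; col-ejected = [] }
pass (d ∷ D) A rA neA (D<d ∷ decD) (A₀<d ∷ A₀<D) with pass D A rA neA decD A₀<D
... | A₁ , D₁ , p
  with splitAt d A₁ (Pass.row-Row p) (subst (0 <_) (sym (Pass.row-length p)) neA)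
         (≤-<-trans (Pass.row-≤ p 0) (⊔-lub A₀<d (headOr0-< D<d (≤-<-trans z≤n A₀<d))))
... | split P {d′} Q d′<d d≤Q = P ++ d ∷ Q , d′ ∷ D₁ , record
  { pass-≈ᴷ = pushed
  ; row-Row = row″
  ; row-length = trans (length-update P d d′ Q) IH.row-length
  ; row-≥ = λ i → ≤-trans (IH.row-≥ i) (at-update-≤ P Q (<⇒≤ d′<d) i)
  ; row-≤ = row-≤
  ; row-Above = row-Above
  ; head-occurs = length P , length-mid P d Q , at-mid P d Q
  ; col-length = cong suc IH.col-length
  ; col-Decreasing = All.map (λ e<h → <-≤-trans e<h headD≤d′) IH.col-< ∷ IH.col-Decreasing
  ; col-< = d′<d ∷ All.map (λ e<h → <-trans e<h headD<d) IH.col-<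
  ; col-ejected = d′-ejected ∷ All.map (Wedged-mono {_≤_} A (P ++ d′ ∷ Q) (P ++ d ∷ Q)
                    (≤-reflexive (length-update P d d′ Q)) (λ i _ → at-update-≤ P Q (<⇒≤ d′<d) i)) IH.col-ejected
  }
  where
  module IH = Pass p
  headD<d : headOr0 D < d
  headD<d = headOr0-< D<d (≤-<-trans z≤n A₀<d)
  headD≤d′ : headOr0 D ≤ d′
  headD≤d′ = head-≤-split D P Q d≤Q IH.row-Row IH.head-occurs D<d
  row″ : Row (P ++ d ∷ Q)
  row″ = Row-update P IH.row-Row (All.map (λ p≤d′ → ≤-trans p≤d′ (<⇒≤ d′<d)) (Row-prefix-≤ P Q IH.row-Row))
                    d≤Q
  pushed : d ∷ D ++ A ≈ᴷ (P ++ d ∷ Q) ++ d′ ∷ D₁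
  pushed = begin
    d ∷ D ++ A                     ≈⟨ ≈ᴷ-congˡ [ d ] IH.pass-≈ᴷ ⟩
    d ∷ (P ++ d′ ∷ Q) ++ D₁        ≈⟨ ≈ᴷ-congʳ D₁ (split-≈ᴷ P Q IH.row-Row d′<d d≤Q) ⟩
    ((P ++ d ∷ Q) ++ [ d′ ]) ++ D₁  ≡⟨ ++-assoc (P ++ d ∷ Q) [ d′ ] D₁ ⟩
    (P ++ d ∷ Q) ++ d′ ∷ D₁        ∎
    where open ≈ᴷ-Reasoning
  left-of-d : ∀ π → π < length A → at (P ++ d′ ∷ Q) π < d → π ≤ length P
  left-of-d π π<A = split-left P d′ Q d≤Q π (subst (π <_) (sym IH.row-length) π<A)
  row-≤ : ∀ i → at (P ++ d ∷ Q) i ≤ at A i ⊔ d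
  row-≤ i with i ≟ length P
  ... | yes refl = subst (_≤ at A i ⊔ d) (sym (at-mid P d Q)) (m≤n⊔m (at A i) d)
  ... | no i≢ = subst (_≤ at A i ⊔ d) (sym (at-update P d d′ Q i i≢))
                  (≤-trans (IH.row-≤ i) (⊔-monoʳ-≤ (at A i) (<⇒≤ headD<d)))
  d′-ejected : Wedged _≤_ A (P ++ d ∷ Q) d′
  d′-ejected =
    length P , subst (length P <_) IH.row-length (length-mid P d′ Q) ,
    subst (at A (length P) ≤_) (at-mid P d′ Q) (IH.row-≥ (length P)) ,
    λ i P≤i i< → <-≤-trans d′<d (subst (_≤ at (P ++ d ∷ Q) i) (at-mid P d Q) (Row-at-mono row″ P≤i i<))
  row-Above : ∀ W → Above A W → All (Wedged _<_ A W) (d ∷ D) → Above (P ++ d ∷ Q) W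
  row-Above W ab ((π , π<A , Aπ<d , d<W) ∷ fits) =
    subst (length W ≤_) (length-update P d′ d Q) (proj₁ A₁-Above-W) , entry
    where
    A₁-Above-W : Above (P ++ d′ ∷ Q) W
    A₁-Above-W = IH.row-Above W ab fits
    entry : ∀ i → i < length W → at (P ++ d ∷ Q) i < at W i
    entry i i<W with i ≟ length P
    ... | yes refl = subst (_< at W i) (sym (at-mid P d Q))
                       (d<W i (left-of-d π π<A (≤-<-trans (IH.row-≤ π) (⊔-lub Aπ<d headD<d))) i<W)
    ... | no i≢ = subst (_< at W i) (sym (at-update P d d′ Q i i≢)) (proj₂ A₁-Above-W i i<W)

-- Peeling one entry off every row

raise-row : ∀ U W m rest → Row (W ++ [ m ]) → (U , W ++ m ∷ rest) ⇝ (U ++ W , m ∷ rest)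
raise-row U [] m rest _ = ≡⇒⇝ (cong (_, m ∷ rest) (sym (++-identityʳ U)))
raise-row U (w ∷ []) m rest ((w≤m ∷ []) ∷ _) = fwd (raise U rest w≤m) ◅ ε
raise-row U (w ∷ w′ ∷ W) m rest ((w≤w′ ∷ _) ∷ row) =
  fwd (raise U (W ++ m ∷ rest) w≤w′) ◅
  (raise-row (U ++ [ w ]) (w′ ∷ W) m rest row ◅◅ ≡⇒⇝ (cong (_, m ∷ rest) (++-assoc U [ w ] (w′ ∷ W))))

-- Ws is T with one entry removed from every row, and E collects the removed entries.
record Peeled (T Ws : Tableau) (E : List ℕ) : Set where
  field
    peel-⇝ : ∀ U rest → (U , reading T ++ rest) ⇝ (U ++ reading Ws , E ++ rest)
    lengths : sh Ws ≡ map pred (sh T)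
    Ws-IsTableau : IsTableau Ws
    E-length : length E ≡ length T
    E-Decreasing : Decreasing E
    first-≥ : ∀ i → i < length (firstRow Ws) → at (firstRow T) i ≤ at (firstRow Ws) i
    E-ejected : All (Wedged _≤_ (firstRow T) (firstRow Ws)) E

firstRow-length : ∀ T Ws → sh Ws ≡ map pred (sh T) → length (firstRow Ws) ≡ pred (length (firstRow T))
firstRow-length [] [] _ = refl
firstRow-length (A ∷ T) (W ∷ Ws) eq = proj₁ (∷-injective eq)

peel : ∀ T → IsTableau T → All NonEmpty T → Σ Tableau λ Ws → Σ (List ℕ) λ E → Peeled T Ws E
peel [] _ _ = [] , [] , record
  { peel-⇝ = λ U rest → ≡⇒⇝ (cong (_, rest) (sym (++-identityʳ U)))
  ; lengths = refl ; Ws-IsTableau = tt ; E-length = refl ; E-Decreasing = []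
  ; first-≥ = λ _ () ; E-ejected = [] }
peel (A ∷ T) (rA , ab , t) (neA ∷ ne) with peel T t ne
... | Ws , E , q
  with pass E A rA neA (Peeled.E-Decreasing q)
         (All.map (Wedged-<-head {W = firstRow Ws} rA ∘ Wedged-up A (firstRow T) (firstRow Ws) ab)
                  (Peeled.E-ejected q))
... | A″ , D″ , p with initLast A″
...   | [] = ⊥-elim (<-irrefl (Pass.row-length p) neA)
...   | W ∷ʳ′ m = W ∷ Ws , m ∷ D″ , record
  { peel-⇝ = peel-⇝
  ; lengths = cong₂ _∷_ W-length IH.lengths
  ; Ws-IsTableau = Row-++⁻ˡ W P.row-Row , W-Above , IH.Ws-IsTableau
  ; E-length = cong suc (trans P.col-length IH.E-length)
  ; E-Decreasing = All.map (λ e<h → <-≤-trans e<h (head-≤-last E W m P.row-Row P.head-occurs)) P.col-<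
                   ∷ P.col-Decreasing
  ; first-≥ = λ i i<W → subst (at A i ≤_) (at-++ˡ W [ m ] i i<W) (P.row-≥ i)
  ; E-ejected = m-ejected ∷ All.map (Wedged-mono {_≤_} A (W ++ [ m ]) W
                  (subst (length W ≤_) (sym (length-snoc W m)) (n≤1+n _))
                  (λ i i<W → ≤-reflexive (at-++ˡ W [ m ] i i<W))) P.col-ejected
  }
  where
  module IH = Peeled q
  module P = Pass p
  B Wb : List ℕ
  B = firstRow T
  Wb = firstRow Ws
  A-length : length A ≡ suc (length W)
  A-length = trans (sym P.row-length) (length-snoc W m)
  W-length : length W ≡ pred (length A)
  W-length = cong pred (sym A-length)
  Wb-length : length Wb ≡ pred (length B)
  Wb-length = firstRow-length T Ws IH.lengths
  Wb≤W : length Wb ≤ length W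
  Wb≤W = subst₂ _≤_ (sym Wb-length) (sym W-length) (pred-mono-≤ (proj₁ ab))
  A-Above-Wb : Above A Wb
  A-Above-Wb = Above-≤ʳ A B Wb ab (subst (_≤ length B) (sym Wb-length) pred[n]≤n) IH.first-≥
  W-Above : Above W Wb
  W-Above = Above-unsnoc W m Wb (P.row-Above Wb A-Above-Wb (All.map (Wedged-up A B Wb ab) IH.E-ejected)) Wb≤W
  m-ejected : Wedged _≤_ A W m
  m-ejected = length W , subst (length W <_) (sym A-length) ≤-refl ,
              subst (at A (length W) ≤_) (at-mid W m []) (P.row-≥ (length W)) ,
              λ i W≤i i<W → ⊥-elim (<⇒≱ i<W W≤i)
  peel-⇝ : ∀ U rest → (U , reading (A ∷ T) ++ rest) ⇝ (U ++ reading (W ∷ Ws) , (m ∷ D″) ++ rest)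
  peel-⇝ U rest = begin
    (U , (reading T ++ A) ++ rest)                ≡⟨ cong (U ,_) (++-assoc (reading T) A rest) ⟩
    (U , reading T ++ A ++ rest)                  ≈⟨ IH.peel-⇝ U (A ++ rest) ⟩
    (U ++ reading Ws , E ++ A ++ rest)            ≡⟨ cong (U ++ reading Ws ,_) (++-assoc E A rest) ⟨
    (U ++ reading Ws , (E ++ A) ++ rest)          ≈⟨ lower* (U ++ reading Ws) (≈ᴷ-congʳ rest P.pass-≈ᴷ) ⟩
    (U ++ reading Ws , ((W ++ [ m ]) ++ D″) ++ rest) ≡⟨ cong (U ++ reading Ws ,_) regroup ⟩
    (U ++ reading Ws , W ++ m ∷ D″ ++ rest)       ≈⟨ raise-row (U ++ reading Ws) W m (D″ ++ rest) P.row-Row ⟩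
    ((U ++ reading Ws) ++ W , m ∷ D″ ++ rest)     ≡⟨ cong (_, m ∷ D″ ++ rest) (++-assoc U (reading Ws) W) ⟩
    (U ++ reading Ws ++ W , m ∷ D″ ++ rest)       ∎
    where
    open ⇝-Reasoning
    regroup : ((W ++ [ m ]) ++ D″) ++ rest ≡ W ++ m ∷ D″ ++ rest
    regroup = trans (++-assoc (W ++ [ m ]) D″ rest) (++-assoc W [ m ] (D″ ++ rest))

insertWordRow : List ℕ → List ℕ → List ℕ × List ℕ
insertWordRow A [] = A , []
insertWordRow A (x ∷ xs) with insertRow x A
... | nothing , A′ = insertWordRow A′ xs
... | just y , A′ = map₂ (y ∷_) (insertWordRow A′ xs)

insertWord-∷ : ∀ A T W →
  insertWord (A ∷ T) W ≡ proj₁ (insertWordRow A W) ∷ insertWord T (proj₂ (insertWordRow A W))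
insertWord-∷ A T [] = refl
insertWord-∷ A T (x ∷ xs) with insertRow x A
... | nothing , A′ = insertWord-∷ A′ T xs
... | just y , A′ = insertWord-∷ A′ (insertT y T) xs

insertWordRow-Above : ∀ P W A → All (λ p → All (p ≤_) W) P → Row W → Above W A →
  insertWordRow (P ++ A) W ≡ (P ++ W , A)
insertWordRow-Above P [] [] _ _ _ = refl
insertWordRow-Above P [] (a ∷ A) _ _ (() , _)
insertWordRow-Above P (w ∷ W) [] P≤wW (w≤W ∷ rW) _
  rewrite ++-identityʳ P | insertRow-appends w P (All.map All.head P≤wW) = begin
    insertWordRow (P ++ [ w ]) W          ≡⟨ cong (λ R → insertWordRow R W) (++-identityʳ (P ++ [ w ])) ⟨
    insertWordRow ((P ++ [ w ]) ++ []) W  ≡⟨ insertWordRow-Above (P ++ [ w ]) W [] P′≤W rW (Above-[] W) ⟩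
    ((P ++ [ w ]) ++ W , [])              ≡⟨ cong (_, []) (++-assoc P [ w ] W) ⟩
    (P ++ w ∷ W , [])                     ∎
  where
  open ≡-Reasoning
  P′≤W : All (λ p → All (p ≤_) W) (P ++ [ w ])
  P′≤W = Allₚ.++⁺ (All.map All.tail P≤wW) (w≤W ∷ [])
insertWordRow-Above P (w ∷ W) (a ∷ A) P≤wW (w≤W ∷ rW) (s≤s A≤W , W<A)
  rewrite insertRow-bumps w P a A (All.map All.head P≤wW) (W<A 0 (s≤s z≤n)) = cong (map₂ (a ∷_)) (begin
    insertWordRow (P ++ w ∷ A) W          ≡⟨ cong (λ R → insertWordRow R W) (++-assoc P [ w ] A) ⟨
    insertWordRow ((P ++ [ w ]) ++ A) W
      ≡⟨ insertWordRow-Above (P ++ [ w ]) W A P′≤W rW (A≤W , λ i → W<A (suc i) ∘ s≤s) ⟩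
    ((P ++ [ w ]) ++ W , A)               ≡⟨ cong (_, A) (++-assoc P [ w ] W) ⟩
    (P ++ w ∷ W , A)                      ∎)
  where
  open ≡-Reasoning
  P′≤W : All (λ p → All (p ≤_) W) (P ++ [ w ])
  P′≤W = Allₚ.++⁺ (All.map All.tail P≤wW) (w≤W ∷ [])

insertWord-Above : ∀ T W → IsTableau T → All NonEmpty T → Row W → NonEmpty W → Above W (firstRow T) →
  insertWord T W ≡ W ∷ T
insertWord-Above [] (w ∷ W) _ _ (w≤W ∷ rW) _ _ =
  trans (insertWord-∷ [ w ] [] W)
        (cong (λ r → proj₁ r ∷ insertWord [] (proj₂ r))
              (insertWordRow-Above [ w ] W [] (w≤W ∷ []) rW (Above-[] W)))
insertWord-Above (A ∷ T) W (rA , abA , t) (neA ∷ ne) rW _ ab =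
  trans (insertWord-∷ A T W)
        (trans (cong (λ r → proj₁ r ∷ insertWord T (proj₂ r)) (insertWordRow-Above [] W A [] rW ab))
               (cong (W ∷_) (insertWord-Above T A t ne rA neA abA)))

dropEmpty : Tableau → Tableau
dropEmpty [] = []
dropEmpty ([] ∷ T) = dropEmpty T
dropEmpty (R@(_ ∷ _) ∷ T) = R ∷ dropEmpty T

dropEmpty-under-[] : ∀ T → IsTableau ([] ∷ T) → dropEmpty T ≡ []
dropEmpty-under-[] [] _ = refl
dropEmpty-under-[] ([] ∷ T) (_ , _ , t) = dropEmpty-under-[] T t
dropEmpty-under-[] ((_ ∷ _) ∷ T) (_ , (() , _) , _)

Above-dropEmpty : ∀ W T → IsTableau T → Above W (firstRow T) → Above W (firstRow (dropEmpty T))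
Above-dropEmpty W [] _ ab = ab
Above-dropEmpty W ([] ∷ T) t _ rewrite dropEmpty-under-[] T t = Above-[] W
Above-dropEmpty W ((_ ∷ _) ∷ T) _ ab = ab

dropEmpty-IsTableau : ∀ T → IsTableau T → IsTableau (dropEmpty T)
dropEmpty-IsTableau [] _ = tt
dropEmpty-IsTableau ([] ∷ T) (_ , _ , t) = dropEmpty-IsTableau T t
dropEmpty-IsTableau (R@(_ ∷ _) ∷ T) (r , ab , t) = r , Above-dropEmpty R T t ab , dropEmpty-IsTableau T t

dropEmpty-NonEmpty : ∀ T → All NonEmpty (dropEmpty T)
dropEmpty-NonEmpty [] = []
dropEmpty-NonEmpty ([] ∷ T) = dropEmpty-NonEmpty T
dropEmpty-NonEmpty ((_ ∷ _) ∷ T) = s≤s z≤n ∷ dropEmpty-NonEmpty T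

S-reading : ∀ T → IsTableau T → S (reading T) ≡ dropEmpty T
S-reading [] _ = refl
S-reading (W ∷ T) (rW , ab , t) = begin
  insertWord [] (reading T ++ W)         ≡⟨ foldl-++ (λ T x → insertT x T) [] (reading T) W ⟩
  insertWord (S (reading T)) W           ≡⟨ cong (λ T′ → insertWord T′ W) (S-reading T t) ⟩
  insertWord (dropEmpty T) W             ≡⟨ on-top W rW ab ⟩
  dropEmpty (W ∷ T)                      ∎
  where
  open ≡-Reasoning
  on-top : ∀ W → Row W → Above W (firstRow T) → insertWord (dropEmpty T) W ≡ dropEmpty (W ∷ T)
  on-top [] _ _ = refl
  on-top W@(_ ∷ _) rW ab =
    insertWord-Above (dropEmpty T) W (dropEmpty-IsTableau T t) (dropEmpty-NonEmpty T) rW (s≤s z≤n)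
                     (Above-dropEmpty W T t ab)

dropZeros : List ℕ → List ℕ
dropZeros [] = []
dropZeros (zero ∷ l) = dropZeros l
dropZeros (suc n ∷ l) = suc n ∷ dropZeros l

sh-dropEmpty : ∀ T → sh (dropEmpty T) ≡ dropZeros (sh T)
sh-dropEmpty [] = refl
sh-dropEmpty ([] ∷ T) = sh-dropEmpty T
sh-dropEmpty ((_ ∷ R) ∷ T) = cong (suc (length R) ∷_) (sh-dropEmpty T)

-- Shapes

insertT-column : ∀ x L → All (x <_) L → AllPairs _<_ L → insertT x (map [_] L) ≡ map [_] (x ∷ L)
insertT-column x [] _ _ = refl
insertT-column x (l ∷ L) (x<l ∷ _) (l<L ∷ incL) with x <? l
... | yes _ = cong ([ x ] ∷_) (insertT-column l L l<L incL)
... | no x≮l = ⊥-elim (x≮l x<l)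

insertWord-column : ∀ E L → Decreasing E → AllPairs _<_ L → All (λ e → All (e <_) L) E →
  insertWord (map [_] L) E ≡ map [_] (E ʳ++ L)
insertWord-column [] L _ _ _ = refl
insertWord-column (e ∷ E) L (E<e ∷ decE) incL (e<L ∷ E<L) rewrite insertT-column e L e<L incL =
  insertWord-column E (e ∷ L) decE (e<L ∷ incL) (All.zipWith (λ (e′<e , e′<L) → e′<e ∷ e′<L) (E<e , E<L))

conj-column : ∀ X → NonEmpty X → conj (sh (map [_] X)) ≡ [ length X ]
conj-column (x ∷ X) _ = cong [_] (count (x ∷ X))
  where
  count : ∀ X → length (filter (1 ≤?_) (sh (map [_] X))) ≡ length X
  count [] = refl
  count (_ ∷ X) = cong suc (count X)

conj-sh-S-Decreasing : ∀ E → NonEmpty E → Decreasing E → conj (sh (S E)) ≡ [ length E ]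
conj-sh-S-Decreasing E neE decE rewrite insertWord-column E [] decE [] (All.universal (λ _ → []) E) =
  trans (conj-column (E ʳ++ []) (subst (0 <_) (sym length-E′) neE)) (cong [_] length-E′)
  where
  length-E′ : length (E ʳ++ []) ≡ length E
  length-E′ = begin
    length (E ʳ++ [])                   ≡⟨ cong length (ʳ++-defn E) ⟩
    length (reverse E ++ [])            ≡⟨ cong length (++-identityʳ (reverse E)) ⟩
    length (reverse E)                  ≡⟨ length-reverse E ⟩
    length E                            ∎
    where open ≡-Reasoning

count≥ : ℕ → List ℕ → ℕ
count≥ j λs = length (filter (j ≤?_) λs)

count≥-pred : ∀ j λs → count≥ (suc (suc j)) λs ≡ count≥ (suc j) (dropZeros (map pred λs))
count≥-pred j [] = refl
count≥-pred j (zero ∷ λs) = count≥-pred j λs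
count≥-pred j (suc zero ∷ λs) = count≥-pred j λs
count≥-pred j (suc (suc l) ∷ λs) with suc j ≤? suc l
... | yes j≤l = begin
  count≥ (suc (suc j)) (suc (suc l) ∷ λs)      ≡⟨ cong length (filter-accept (suc (suc j) ≤?_) (s≤s j≤l)) ⟩
  suc (count≥ (suc (suc j)) λs)                ≡⟨ cong suc (count≥-pred j λs) ⟩
  suc (count≥ (suc j) (dropZeros (map pred λs))) ≡⟨ cong length (filter-accept (suc j ≤?_) j≤l) ⟨
  count≥ (suc j) (suc l ∷ dropZeros (map pred λs)) ∎
  where open ≡-Reasoning
... | no j≰l = begin
  count≥ (suc (suc j)) (suc (suc l) ∷ λs)      ≡⟨ cong length (filter-reject (suc (suc j) ≤?_) (j≰l ∘ ≤-pred)) ⟩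
  count≥ (suc (suc j)) λs                      ≡⟨ count≥-pred j λs ⟩
  count≥ (suc j) (dropZeros (map pred λs))     ≡⟨ cong length (filter-reject (suc j ≤?_) j≰l) ⟨
  count≥ (suc j) (suc l ∷ dropZeros (map pred λs)) ∎
  where open ≡-Reasoning

dropZeros-≤1 : ∀ λs → All (_≤ 1) λs → dropZeros (map pred λs) ≡ []
dropZeros-≤1 [] _ = refl
dropZeros-≤1 (zero ∷ λs) (_ ∷ λs≤1) = dropZeros-≤1 λs λs≤1
dropZeros-≤1 (suc zero ∷ λs) (_ ∷ λs≤1) = dropZeros-≤1 λs λs≤1
dropZeros-≤1 (suc (suc _) ∷ _) (s≤s () ∷ _)

headOr0-dropZeros : ∀ n λs → All (_≤ suc n) λs → headOr0 (dropZeros (n ∷ map pred λs)) ≡ n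
headOr0-dropZeros zero λs λs≤1 rewrite dropZeros-≤1 λs λs≤1 = refl
headOr0-dropZeros (suc n) λs _ = refl

-- Removing the first column of a partition (λ₁ = suc n) removes the first part of its conjugate.
conj-∷ : ∀ n λs → All (1 ≤_) λs → All (_≤ suc n) λs →
  conj (suc n ∷ λs) ≡ length (suc n ∷ λs) ∷ conj (dropZeros (n ∷ map pred λs))
conj-∷ n λs λs≥1 λs≤ = cong₂ _∷_ (cong length (filter-all (1 ≤?_) {xs = suc n ∷ λs} (s≤s z≤n ∷ λs≥1))) (begin
  map (λ j → count≥ (suc j) (suc n ∷ λs)) (applyUpTo suc n)  ≡⟨ map-applyUpTo suc _ n ⟩
  applyUpTo (λ j → count≥ (suc (suc j)) (suc n ∷ λs)) n      ≡⟨ applyUpTo-cong (λ j → count≥-pred j (suc n ∷ λs)) n ⟩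
  applyUpTo (λ j → count≥ (suc j) μs) n                      ≡⟨ map-applyUpTo id _ n ⟨
  map (λ j → count≥ (suc j) μs) (upTo n)                     ≡⟨ cong (map (λ j → count≥ (suc j) μs) ∘ upTo) n≡ ⟩
  conj μs                                                    ∎)
  where
  open ≡-Reasoning
  μs : List ℕ
  μs = dropZeros (n ∷ map pred λs)
  n≡ : n ≡ headOr0 μs
  n≡ = sym (headOr0-dropZeros n λs λs≤)
  applyUpTo-cong : ∀ {f g : ℕ → ℕ} → (∀ j → f j ≡ g j) → ∀ n → applyUpTo f n ≡ applyUpTo g n
  applyUpTo-cong f≗g zero = refl
  applyUpTo-cong f≗g (suc n) = cong₂ _∷_ (f≗g 0) (applyUpTo-cong (f≗g ∘ suc) n)

IsTableau-shorter : ∀ A T → IsTableau (A ∷ T) → All (λ R → length R ≤ length A) T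
IsTableau-shorter A T (_ , (T≤A , _) , t) = go T t T≤A
  where
  go : ∀ T → IsTableau T → length (firstRow T) ≤ length A → All (λ R → length R ≤ length A) T
  go [] _ _ = []
  go (B ∷ T) (_ , (T≤B , _) , t) B≤A = B≤A ∷ go T t (≤-trans T≤B B≤A)

conj-sh-NonEmpty : ∀ (T : Tableau) {c cs} → conj (sh T) ≡ c ∷ cs → NonEmpty T
conj-sh-NonEmpty (_ ∷ _) _ = s≤s z≤n

conj-sh-IsTableau : ∀ T → IsTableau T → All NonEmpty T → ∀ {c cs} → conj (sh T) ≡ c ∷ cs →
  c ≡ length T × conj (dropZeros (map pred (sh T))) ≡ cs
conj-sh-IsTableau ((a ∷ A) ∷ T) t (_ ∷ ne) eq
  with ∷-injective (trans (sym eq) (conj-∷ (length A) (sh T) (Allₚ.map⁺ ne)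
                                          (Allₚ.map⁺ (IsTableau-shorter (a ∷ A) T t))))
... | c≡ , cs≡ = trans c≡ (length-map length ((a ∷ A) ∷ T)) , sym cs≡

lemma2p10 : (k : ℕ) → 1 ≤ k → (as : List ℕ) → IsKBiword k as →
    (c : ℕ) → (cs : List ℕ) → conj (sh (S as)) ≡ c ∷ cs →
    Σ (List ℕ) (λ a1 → Σ (List ℕ) (λ ac →
    IsKBiword (suc k) a1 × IsKBiword k ac ×
    (kBiword as k ∼ kBiword a1 (suc k) ++ kBiword ac k) ×
    (conj (sh (S a1)) ≡ cs) × (conj (sh (S ac)) ≡ c ∷ [])))
lemma2p10 k _ as (valid , _) c cs conj≡ with S-IsTableau as
... | t , ne with peel (S as) t ne
... | Ws , E , q =
  reading Ws , E ,
  Plactic-kBiword (suc k) (reading Ws) (All.map Letter-suc (Allₚ.++⁻ˡ (reading Ws) letters)) ,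
  Plactic-kBiword k E (Allₚ.++⁻ʳ (reading Ws) letters) ,
  TwoLevel.⇝⇒∼ k path (Allₚ.map⁻ valid) ,
  (begin
    conj (sh (S (reading Ws)))         ≡⟨ cong (conj ∘ sh) (S-reading Ws Ws-IsTableau) ⟩
    conj (sh (dropEmpty Ws))           ≡⟨ cong conj (trans (sh-dropEmpty Ws) (cong dropZeros lengths)) ⟩
    conj (dropZeros (map pred (sh T))) ≡⟨ proj₂ shape ⟩
    cs                                 ∎) ,
  trans (conj-sh-S-Decreasing E E-NonEmpty E-Decreasing) (cong [_] (trans E-length (sym (proj₁ shape))))
  where
  open Peeled q
  open ≡-Reasoning
  T : Tableau
  T = S as
  shape : c ≡ length T × conj (dropZeros (map pred (sh T))) ≡ cs
  shape = conj-sh-IsTableau T t ne conj≡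
  E-NonEmpty : NonEmpty E
  E-NonEmpty = subst (0 <_) (sym E-length) (conj-sh-NonEmpty T conj≡)
  path : ([] , as) ⇝ (reading Ws , E)
  path = lower* [] (S-≈ᴷ as) ◅◅ ≡⇒⇝ (cong ([] ,_) (sym (++-identityʳ (reading T))))
         ◅◅ peel-⇝ [] [] ◅◅ ≡⇒⇝ (cong (reading Ws ,_) (++-identityʳ E))
  letters : All (Letter k) (reading Ws ++ E)
  letters = All-resp-↭ (⇝⇒↭ path) (Allₚ.map⁻ valid)
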